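{- Let $n\ge1$ and let $A_{ij}$ be the coefficient of $u^iv^jw^{n-i-j}$ in the numerator $P_{1/n}(u,v,w)$ of the Markov polynomial $M_{1/n}$. Let $\Delta$ be the set of integer points $(i,j)$ with $i,j\ge0$, $i+\frac jn\ge1$, $i+j\le n$. Then along every line of each of the three principal directions—horizontal ($j$ constant), vertical ($i$ constant) and diagonal ($i+j$ constant)—the sequence of values $A_{ij}$ at the consecutive points of $\Delta$ on that line is log-concave.
   Context: A sequence $(x_0,\dots,x_m)$ is log-concave if $x_k^2\ge x_{k-1}x_{k+1}$ for all $1\le k\le m-1$. Markov polynomials $M_\rho(x,y,z)$, $\rho\in\mathbb{Q}_{\ge0}\cup\{1/0\}$, are defined recursively by $M_{0/1}=x$, $M_{1/0}=y$, $M_{1/1}=(x^2+y^2)/z$, and: whenever $p/q$, $r/s$ are fractions in lowest terms with $p,q,r,s\ge0$, $qr-ps=1$, mediant $\mu=(p+r)/(q+s)$, then $M_{(2p+r)/(2q+s)}=(M_{p/q}^2+M_\mu^2)/M_{r/s}$ and $M_{(p+2r)/(q+2s)}=(M_\mu^2+M_{r/s}^2)/M_{p/q}$. For coprime positive $a,b$, $M_{a/b}=P_{a/b}(x^2,y^2,z^2)/(x^{a-1}y^{b-1}z^{a+b-1})$ with $P_{a/b}(u,v,w)$ homogeneous of degree $a+b-1$ (the numerator). -}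

module Defs where

open import Data.Nat as ℕ using (ℕ; zero; suc; _∸_)
open import Data.Integer as ℤ using (ℤ; +_)
open import Data.Product using (_×_)
open import Data.Bool using (if_then_else_; _∧_)
open import Relation.Binary.PropositionalEquality using (_≡_)

-- Formal power series in three commuting variables u, v, w over ℤ,
-- given by their coefficient function: s i j k = coefficient of u^i v^j w^k.
-- (Polynomials ℤ[u,v,w] embed faithfully; products are exact finite convolutions.)
Series : Set
Series = ℕ → ℕ → ℕ → ℤ

sumTo : ℕ → (ℕ → ℤ) → ℤ
sumTo zero    f = f zero
sumTo (suc n) f = sumTo n f ℤ.+ f (suc n)

infixl 6 _⊕_
infixl 7 _⊛_
infix  4 _≈ˢ_

_⊕_ : Series → Series → Series
(f ⊕ g) i j k = f i j k ℤ.+ g i j k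

_⊛_ : Series → Series → Series
(f ⊛ g) i j k =
  sumTo i λ a → sumTo j λ b → sumTo k λ c →
    f a b c ℤ.* g (i ∸ a) (j ∸ b) (k ∸ c)

_≈ˢ_ : Series → Series → Set
f ≈ˢ g = ∀ i j k → f i j k ≡ g i j k

mono : ℕ → ℕ → ℕ → Series
mono a b c i j k =
  if (i ℕ.≡ᵇ a) ∧ (j ℕ.≡ᵇ b) ∧ (k ℕ.≡ᵇ c) then + 1 else + 0

one uˢ vˢ wˢ : Series
one = mono 0 0 0
uˢ  = mono 1 0 0
vˢ  = mono 0 1 0
wˢ  = mono 0 0 1

-- Numerators P_{1/n}(u,v,w) of the Markov polynomials M_{1/n}
-- (u = x², v = y², w = z²), where M_{1/n} = P_{1/n} / (y^{n-1} z^n).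
-- From M_{1/0} = y, M_{1/1} = (x²+y²)/z and the Markov rule applied to the
-- pair 0/1, 1/n (mediant 1/(n+1)):  M_{1/(n+2)} M_{1/n} = x² + M_{1/(n+1)}²,
-- which after clearing denominators reads
--   P_{1/(m+2)} · P_{1/m} = u v^m w^(m+1) + P_{1/(m+1)}²,
-- with P_{1/0} = 1 and P_{1/1} = u + v.  Since ℤ[[u,v,w]] is an integral
-- domain and each P_{1/m} ≠ 0, these equations determine P uniquely.
IsMarkovNumerators : (ℕ → Series) → Set
IsMarkovNumerators P =
  (P 0 ≈ˢ one) ×
  (P 1 ≈ˢ uˢ ⊕ vˢ) ×
  (∀ m → P (suc (suc m)) ⊛ P m ≈ˢ mono 1 m (suc m) ⊕ P (suc m) ⊛ P (suc m))

coeffA : (ℕ → Series) → ℕ → ℕ → ℕ → ℤ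
coeffA P n i j = P n i j (n ∸ (i ℕ.+ j))

-- Δ = { (i,j) ∈ ℕ² : i + j/n ≥ 1, i + j ≤ n }   (i + j/n ≥ 1  ⇔  n ≤ n·i + j)
InΔ : ℕ → ℕ → ℕ → Set
InΔ n i j = (n ℕ.≤ n ℕ.* i ℕ.+ j) × (i ℕ.+ j ℕ.≤ n)

LCAt : ℤ → ℤ → ℤ → Set
LCAt x y z = x ℤ.* z ℤ.≤ y ℤ.* y

{-# OPTIONS --safe #-}
-- The numerators obey the linear recurrence P_{n+2} = (u + v + w) P_{n+1} - vw P_n with P_0 = 1,
-- P_1 = u + v.  Indeed, for any second-order linear recurrence q_{n+2} = s q_{n+1} - e q_n the
-- Casoratian q_{n+2} q_n - q_{n+1}^2 gets multiplied by e at each step, so the solution Q of this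
-- recurrence satisfies the Markov relation Q_{n+2} Q_n = u v^n w^{n+1} + Q_{n+1}^2; and the Markov
-- relation determines P_{n+2} from P_{n+1}, P_n because Q_n, whose lowest-order term in u is v^n,
-- is a non-zero-divisor of ℤ[[u,v,w]].  Solving the recurrence coefficientwise, P_{1/n} is homogeneous
-- of degree n with coefficient T(i,j,k) = C(i+j, j) C(i-1+k, k) at u^i v^j w^k (for i ≥ 1; for
-- i = 0 it is 1 at v^n and 0 elsewhere).  Along each of the three lines of Δ this is a product
-- of two binomial sequences that are log-concave (by comparing consecutive ratios with the absorption
-- identity), and a product of log-concave sequences is log-concave.
module Submission where

open import Level using (Level; _⊔_)
open import Algebra.Bundles using (CommutativeRing)
open import Algebra.Structures using (IsCommutativeRing)
import Algebra.Construct.Pointwise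
import Algebra.Properties.CommutativeSemigroup as CommutativeSemigroupProperties
import Algebra.Properties.Ring as RingProperties
open import Data.Bool as Bool using (true; false; if_then_else_)
open import Data.Integer as ℤ using (ℤ; +_)
import Data.Integer.Properties as ℤ
open import Data.Nat as ℕ using (ℕ; zero; suc; _∸_; _≤_; _<_; z≤n; s≤s)
open import Data.Nat.Induction using (<-rec)
import Data.Nat.Properties as ℕ
open import Data.Nat.Tactic.RingSolver using (solve-∀)
open import Data.Product using (_×_; _,_; proj₂)
open import Function using (_∘_)
open import Relation.Binary.Definitions using (tri<; tri≈; tri>)
open import Relation.Binary.PropositionalEquality as ≡ using (_≡_; _≢_; refl)
import Relation.Binary.Reasoning.Setoid as SetoidReasoning
open import Relation.Nullary using (yes; no; contradiction)

open import Defs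

module _ {c ℓ : Level} (R : CommutativeRing c ℓ) where
  open CommutativeRing R

  NonZeroDivisor : Carrier → Set (c ⊔ ℓ)
  NonZeroDivisor x = ∀ {y} → y * x ≈ 0# → y ≈ 0#

  1#-nonZeroDivisor : NonZeroDivisor 1#
  1#-nonZeroDivisor {y} y1≈0 = trans (sym (*-identityʳ y)) y1≈0

  nonZeroDivisor-cancelʳ : ∀ {x y z} → NonZeroDivisor x → y * x ≈ z * x → y ≈ z
  nonZeroDivisor-cancelʳ {x} {y} {z} regular yx≈zx =
    x∙y⁻¹≈ε⇒x≈y y z (regular (trans ([y-z]x≈yx-zx x y z) (x≈y⇒x∙y⁻¹≈ε yx≈zx)))
    where open RingProperties ring

module PowerSeriesRing {c ℓ : Level} (R : CommutativeRing c ℓ) where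
  open CommutativeRing R hiding (zero) renaming (refl to ≈-refl)
  open SetoidReasoning setoid

  ∑ : ℕ → (ℕ → Carrier) → Carrier
  ∑ zero    f = f zero
  ∑ (suc n) f = ∑ n f + f (suc n)

  ∑-cong : ∀ n {f g} → (∀ a → a ≤ n → f a ≈ g a) → ∑ n f ≈ ∑ n g
  ∑-cong zero    f≈g = f≈g zero z≤n
  ∑-cong (suc n) f≈g =
    +-cong (∑-cong n λ a a≤n → f≈g a (ℕ.m≤n⇒m≤1+n a≤n)) (f≈g (suc n) ℕ.≤-refl)

  ∑-zero : ∀ n {f} → (∀ a → a ≤ n → f a ≈ 0#) → ∑ n f ≈ 0#
  ∑-zero n f≈0 = trans (∑-cong n f≈0) (∑-const-0 n)
    where
    ∑-const-0 : ∀ n → ∑ n (λ _ → 0#) ≈ 0#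
    ∑-const-0 zero    = ≈-refl
    ∑-const-0 (suc n) = trans (+-identityʳ _) (∑-const-0 n)

  ∑-single : ∀ n t {f} → t ≤ n → (∀ a → a ≤ n → a ≢ t → f a ≈ 0#) → ∑ n f ≈ f t
  ∑-single zero    zero    z≤n _   = ≈-refl
  ∑-single (suc n) t       t≤1+n others with t ℕ.≟ suc n
  ... | yes refl = trans
          (+-congʳ (∑-zero n λ a a≤n → others a (ℕ.m≤n⇒m≤1+n a≤n) (ℕ.<⇒≢ (s≤s a≤n))))
          (+-identityˡ _)
  ... | no  t≢1+n = trans (+-congˡ (others (suc n) ℕ.≤-refl (t≢1+n ∘ ≡.sym)))
                    (trans (+-identityʳ _)
                           (∑-single n t (ℕ.≤-pred (ℕ.≤∧≢⇒< t≤1+n t≢1+n))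
                                     λ a a≤n → others a (ℕ.m≤n⇒m≤1+n a≤n)))

  ∑-distrib-+ : ∀ n f g → ∑ n (λ a → f a + g a) ≈ ∑ n f + ∑ n g
  ∑-distrib-+ zero    f g = ≈-refl
  ∑-distrib-+ (suc n) f g =
    trans (+-congʳ (∑-distrib-+ n f g)) (interchange (∑ n f) (∑ n g) (f (suc n)) (g (suc n)))
    where open CommutativeSemigroupProperties +-commutativeSemigroup using (interchange)

  *-distribˡ-∑ : ∀ n x f → x * ∑ n f ≈ ∑ n (λ a → x * f a)
  *-distribˡ-∑ zero    x f = ≈-refl
  *-distribˡ-∑ (suc n) x f = trans (distribˡ x (∑ n f) (f (suc n))) (+-congʳ (*-distribˡ-∑ n x f))

  *-distribʳ-∑ : ∀ n x f → ∑ n f * x ≈ ∑ n (λ a → f a * x)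
  *-distribʳ-∑ zero    x f = ≈-refl
  *-distribʳ-∑ (suc n) x f = trans (distribʳ x (∑ n f) (f (suc n))) (+-congʳ (*-distribʳ-∑ n x f))

  ∑-unfoldˡ : ∀ n f → ∑ (suc n) f ≈ f 0 + ∑ n (λ a → f (suc a))
  ∑-unfoldˡ zero    f = ≈-refl
  ∑-unfoldˡ (suc n) f = trans (+-congʳ (∑-unfoldˡ n f)) (+-assoc _ _ _)

  ∑-reverse : ∀ n f → ∑ n f ≈ ∑ n (λ a → f (n ∸ a))
  ∑-reverse zero    f = ≈-refl
  ∑-reverse (suc n) f = begin
    ∑ n f + f (suc n)                  ≈⟨ +-congʳ (∑-reverse n f) ⟩
    ∑ n (λ a → f (n ∸ a)) + f (suc n)  ≈⟨ +-comm _ _ ⟩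
    f (suc n) + ∑ n (λ a → f (n ∸ a))  ≈⟨ ∑-unfoldˡ n (λ a → f (suc n ∸ a)) ⟨
    ∑ (suc n) (λ a → f (suc n ∸ a))    ∎

  ∑-triangle : ∀ n (F : ℕ → ℕ → Carrier) →
    ∑ n (λ a → ∑ a (F a)) ≈ ∑ n (λ b → ∑ (n ∸ b) (λ d → F (b ℕ.+ d) b))
  ∑-triangle zero    F = ≈-refl
  ∑-triangle (suc n) F = begin
    ∑ n (λ a → ∑ a (F a)) + (∑ n (F (suc n)) + F (suc n) (suc n))
      ≈⟨ +-congʳ (∑-triangle n F) ⟩
    ∑ n (λ b → ∑ (n ∸ b) (λ d → F (b ℕ.+ d) b)) + (∑ n (F (suc n)) + F (suc n) (suc n))
      ≈⟨ +-assoc _ _ _ ⟨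
    ∑ n (λ b → ∑ (n ∸ b) (λ d → F (b ℕ.+ d) b)) + ∑ n (F (suc n)) + F (suc n) (suc n)
      ≈⟨ +-congʳ (∑-distrib-+ n _ _) ⟨
    ∑ n (λ b → ∑ (n ∸ b) (λ d → F (b ℕ.+ d) b) + F (suc n) b) + F (suc n) (suc n)
      ≈⟨ +-cong (∑-cong n extend-column) last-column ⟨
    ∑ (suc n) (λ b → ∑ (suc n ∸ b) (λ d → F (b ℕ.+ d) b))
      ∎
    where
    extend-column : ∀ b → b ≤ n →
      ∑ (suc n ∸ b) (λ d → F (b ℕ.+ d) b) ≈ ∑ (n ∸ b) (λ d → F (b ℕ.+ d) b) + F (suc n) b
    extend-column b b≤n rewrite ℕ.+-∸-assoc 1 b≤n = +-congˡ (reflexive (≡.cong (λ m → F m b)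
      (≡.trans (ℕ.+-suc b (n ∸ b)) (≡.cong suc (ℕ.m+[n∸m]≡n b≤n)))))
    last-column : ∑ (n ∸ n) (λ d → F (suc n ℕ.+ d) (suc n)) ≈ F (suc n) (suc n)
    last-column rewrite ℕ.n∸n≡0 n | ℕ.+-identityʳ n = ≈-refl

  PowerSeries : Set c
  PowerSeries = ℕ → Carrier

  infix  4 _≈ₚ_
  infixl 6 _+ₚ_
  infixl 7 _*ₚ_

  _≈ₚ_ : PowerSeries → PowerSeries → Set ℓ
  f ≈ₚ g = ∀ i → f i ≈ g i

  _+ₚ_ _*ₚ_ : PowerSeries → PowerSeries → PowerSeries
  (f +ₚ g) i = f i + g i
  (f *ₚ g) i = ∑ i (λ a → f a * g (i ∸ a))

  -ₚ_ : PowerSeries → PowerSeries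
  (-ₚ f) i = - f i

  monomial : ℕ → Carrier → PowerSeries
  monomial a x i = if i ℕ.≡ᵇ a then x else 0#

  0ₚ 1ₚ : PowerSeries
  0ₚ _ = 0#
  1ₚ   = monomial 0 1#

  shift : ℕ → PowerSeries → PowerSeries
  shift zero    f         = f
  shift (suc a) f zero    = 0#
  shift (suc a) f (suc i) = shift a f i

  monomial-*ₚ : ∀ a x f → monomial a x *ₚ f ≈ₚ shift a (λ i → x * f i)
  monomial-*ₚ zero    x f zero    = ≈-refl
  monomial-*ₚ zero    x f (suc i) = begin
    ∑ (suc i) (λ b → monomial 0 x b * f (suc i ∸ b))   ≈⟨ ∑-unfoldˡ i _ ⟩
    x * f (suc i) + ∑ i (λ b → 0# * f (i ∸ b))         ≈⟨ +-congˡ (∑-zero i λ b _ → zeroˡ _) ⟩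
    x * f (suc i) + 0#                                  ≈⟨ +-identityʳ _ ⟩
    x * f (suc i)                                       ∎
  monomial-*ₚ (suc a) x f zero    = zeroˡ (f 0)
  monomial-*ₚ (suc a) x f (suc i) = begin
    ∑ (suc i) (λ b → monomial (suc a) x b * f (suc i ∸ b))   ≈⟨ ∑-unfoldˡ i _ ⟩
    0# * f (suc i) + (monomial a x *ₚ f) i                    ≈⟨ +-cong (zeroˡ _) (monomial-*ₚ a x f i) ⟩
    0# + shift a (λ i → x * f i) i                            ≈⟨ +-identityˡ _ ⟩
    shift a (λ i → x * f i) i                                 ∎

  *ₚ-comm : ∀ f g → f *ₚ g ≈ₚ g *ₚ f
  *ₚ-comm f g i = trans (∑-reverse i _) (∑-cong i λ a a≤i →
    trans (*-comm _ _) (*-congʳ (reflexive (≡.cong g (ℕ.m∸[m∸n]≡n a≤i)))))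

  *ₚ-assoc : ∀ f g h → (f *ₚ g) *ₚ h ≈ₚ f *ₚ (g *ₚ h)
  *ₚ-assoc f g h i = begin
    ∑ i (λ a → ∑ a (λ b → f b * g (a ∸ b)) * h (i ∸ a))
      ≈⟨ ∑-cong i (λ a _ → *-distribʳ-∑ a _ _) ⟩
    ∑ i (λ a → ∑ a (λ b → (f b * g (a ∸ b)) * h (i ∸ a)))
      ≈⟨ ∑-triangle i (λ a b → (f b * g (a ∸ b)) * h (i ∸ a)) ⟩
    ∑ i (λ b → ∑ (i ∸ b) (λ d → (f b * g (b ℕ.+ d ∸ b)) * h (i ∸ (b ℕ.+ d))))
      ≈⟨ ∑-cong i (λ b _ → ∑-cong (i ∸ b) λ d _ → trans (*-assoc _ _ _) (*-congˡ (*-cong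
           (reflexive (≡.cong g (ℕ.m+n∸m≡n b d)))
           (reflexive (≡.cong h (≡.sym (ℕ.∸-+-assoc i b d))))))) ⟩
    ∑ i (λ b → ∑ (i ∸ b) (λ d → f b * (g d * h (i ∸ b ∸ d))))
      ≈⟨ ∑-cong i (λ b _ → *-distribˡ-∑ (i ∸ b) (f b) _) ⟨
    ∑ i (λ b → f b * ∑ (i ∸ b) (λ d → g d * h (i ∸ b ∸ d)))
      ∎

  *ₚ-identityˡ : ∀ f → 1ₚ *ₚ f ≈ₚ f
  *ₚ-identityˡ f i = trans (monomial-*ₚ 0 1# f i) (*-identityˡ (f i))

  *ₚ-distribˡ : ∀ f g h → f *ₚ (g +ₚ h) ≈ₚ f *ₚ g +ₚ f *ₚ h
  *ₚ-distribˡ f g h i = trans (∑-cong i λ a _ → distribˡ _ _ _) (∑-distrib-+ i _ _)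

  *ₚ-cong : ∀ {f f′ g g′} → f ≈ₚ f′ → g ≈ₚ g′ → f *ₚ g ≈ₚ f′ *ₚ g′
  *ₚ-cong f≈f′ g≈g′ i = ∑-cong i λ a _ → *-cong (f≈f′ a) (g≈g′ (i ∸ a))

  *ₚ-identityʳ : ∀ f → f *ₚ 1ₚ ≈ₚ f
  *ₚ-identityʳ f i = trans (*ₚ-comm f 1ₚ i) (*ₚ-identityˡ f i)

  *ₚ-distribʳ : ∀ f g h → (g +ₚ h) *ₚ f ≈ₚ g *ₚ f +ₚ h *ₚ f
  *ₚ-distribʳ f g h i =
    trans (*ₚ-comm (g +ₚ h) f i) (trans (*ₚ-distribˡ f g h i) (+-cong (*ₚ-comm f g i) (*ₚ-comm f h i)))

  isCommutativeRingₚ : IsCommutativeRing _≈ₚ_ _+ₚ_ _*ₚ_ -ₚ_ 0ₚ 1ₚ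
  isCommutativeRingₚ = record
    { isRing = record
      { +-isAbelianGroup = Algebra.Construct.Pointwise.isAbelianGroup ℕ +-isAbelianGroup
      ; *-cong           = *ₚ-cong
      ; *-assoc          = *ₚ-assoc
      ; *-identity       = *ₚ-identityˡ , *ₚ-identityʳ
      ; distrib          = *ₚ-distribˡ , *ₚ-distribʳ
      }
    ; *-comm = *ₚ-comm
    }

  commutativeRing : CommutativeRing c ℓ
  commutativeRing = record { isCommutativeRing = isCommutativeRingₚ }

  shift-cong : ∀ a {f g} → f ≈ₚ g → shift a f ≈ₚ shift a g
  shift-cong zero    f≈g i       = f≈g i
  shift-cong (suc a) f≈g zero    = ≈-refl
  shift-cong (suc a) f≈g (suc i) = shift-cong a f≈g i

  monomial-1#-*ₚ : ∀ a f → monomial a 1# *ₚ f ≈ₚ shift a f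
  monomial-1#-*ₚ a f i = trans (monomial-*ₚ a 1# f i) (shift-cong a (λ j → *-identityˡ (f j)) i)

  initial-nonZeroDivisor : ∀ a {f} → (∀ x → x < a → f x ≈ 0#) →
    NonZeroDivisor R (f a) → NonZeroDivisor commutativeRing f
  initial-nonZeroDivisor a {f} f<a≈0 fa-regular {d} d*f≈0 = <-rec (λ i → d i ≈ 0#) d≈0
    where
    -- Once d vanishes below i, the coefficient of t^(i + a) in d * f is d i * f a.
    d≈0 : ∀ i → (∀ {x} → x < i → d x ≈ 0#) → d i ≈ 0#
    d≈0 i d<i≈0 = fa-regular (begin
      d i * f a                              ≈⟨ *-congˡ (reflexive (≡.cong f (ℕ.m+n∸m≡n i a))) ⟨
      d i * f (i ℕ.+ a ∸ i)                  ≈⟨ ∑-single (i ℕ.+ a) i (ℕ.m≤m+n i a) others ⟨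
      ∑ (i ℕ.+ a) (λ x → d x * f (i ℕ.+ a ∸ x))  ≈⟨ d*f≈0 (i ℕ.+ a) ⟩
      0#                                     ∎)
      where
      others : ∀ x → x ≤ i ℕ.+ a → x ≢ i → d x * f (i ℕ.+ a ∸ x) ≈ 0#
      others x x≤i+a x≢i with ℕ.<-cmp x i
      ... | tri< x<i _ _ = trans (*-congʳ (d<i≈0 x<i)) (zeroˡ _)
      ... | tri≈ _ x≡i _ = contradiction x≡i x≢i
      ... | tri> _ _ i<x = trans (*-congˡ (f<a≈0 _ (ℕ.<-≤-trans (ℕ.∸-monoʳ-< i<x x≤i+a)
                                                           (ℕ.≤-reflexive (ℕ.m+n∸m≡n i a)))))
                                 (zeroʳ _)

module Casoratian {c ℓ : Level} (R : CommutativeRing c ℓ) where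
  open CommutativeRing R
  open RingProperties ring using (+-cancelʳ)
  open CommutativeSemigroupProperties *-commutativeSemigroup using (xy∙z≈y∙xz; x∙yz≈y∙xz)
  open SetoidReasoning setoid

  casoratian-step : ∀ {s e q₀ q₁ q₂ q₃} → q₂ + e * q₀ ≈ s * q₁ → q₃ + e * q₁ ≈ s * q₂ →
    q₃ * q₁ + e * (q₁ * q₁) ≈ q₂ * q₂ + e * (q₂ * q₀)
  casoratian-step {s} {e} {q₀} {q₁} {q₂} {q₃} rec₀ rec₁ = begin
    q₃ * q₁ + e * (q₁ * q₁)   ≈⟨ +-congˡ (*-assoc e q₁ q₁) ⟨
    q₃ * q₁ + e * q₁ * q₁     ≈⟨ distribʳ q₁ q₃ (e * q₁) ⟨
    (q₃ + e * q₁) * q₁        ≈⟨ *-congʳ rec₁ ⟩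
    s * q₂ * q₁               ≈⟨ xy∙z≈y∙xz s q₂ q₁ ⟩
    q₂ * (s * q₁)             ≈⟨ *-congˡ rec₀ ⟨
    q₂ * (q₂ + e * q₀)        ≈⟨ distribˡ q₂ q₂ (e * q₀) ⟩
    q₂ * q₂ + q₂ * (e * q₀)   ≈⟨ +-congˡ (x∙yz≈y∙xz q₂ e q₀) ⟩
    q₂ * q₂ + e * (q₂ * q₀)   ∎

  casoratian : ∀ {s e} (q x : ℕ → Carrier) →
    (∀ n → q (suc (suc n)) ≈ s * q (suc n) - e * q n) →
    (∀ n → x (suc n) ≈ e * x n) →
    q 2 * q 0 ≈ x 0 + q 1 * q 1 →
    ∀ n → q (suc (suc n)) * q n ≈ x n + q (suc n) * q (suc n)
  casoratian q x rec x-rec base zero    = base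
  casoratian {s} {e} q x rec x-rec base (suc n) =
    +-cancelʳ (e * (q₁ * q₁)) (q₃ * q₁) (x (suc n) + q₂ * q₂) (begin
      q₃ * q₁ + e * (q₁ * q₁)             ≈⟨ casoratian-step (rec′ n) (rec′ (suc n)) ⟩
      q₂ * q₂ + e * (q₂ * q₀)             ≈⟨ +-congˡ (*-congˡ (casoratian q x rec x-rec base n)) ⟩
      q₂ * q₂ + e * (x n + q₁ * q₁)       ≈⟨ +-congˡ (distribˡ e (x n) (q₁ * q₁)) ⟩
      q₂ * q₂ + (e * x n + e * (q₁ * q₁)) ≈⟨ +-assoc _ _ _ ⟨
      q₂ * q₂ + e * x n + e * (q₁ * q₁)   ≈⟨ +-congʳ (+-comm _ _) ⟩
      e * x n + q₂ * q₂ + e * (q₁ * q₁)   ≈⟨ +-congʳ (+-congʳ (x-rec n)) ⟨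
      x (suc n) + q₂ * q₂ + e * (q₁ * q₁) ∎)
    where
    q₀ = q n
    q₁ = q (suc n)
    q₂ = q (suc (suc n))
    q₃ = q (suc (suc (suc n)))
    rec′ : ∀ m → q (suc (suc m)) + e * q m ≈ s * q (suc m)
    rec′ m = begin
      q (suc (suc m)) + e * q m                   ≈⟨ +-congʳ (rec m) ⟩
      s * q (suc m) - e * q m + e * q m           ≈⟨ +-assoc _ _ _ ⟩
      s * q (suc m) + (- (e * q m) + e * q m)     ≈⟨ +-congˡ (-‿inverseˡ _) ⟩
      s * q (suc m) + 0#                          ≈⟨ +-identityʳ _ ⟩
      s * q (suc m)                               ∎

module Pascal where

  open import Data.Nat as ℕ using (ℕ; zero; suc; _+_; _*_; _≤_; z≤n; NonZero)
  import Data.Nat.Properties as ℕ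
  open import Data.Nat.Tactic.RingSolver using (solve-∀)
  open import Relation.Binary.PropositionalEquality as ≡ using (_≡_; refl)
  open import Algebra.Properties.CommutativeSemigroup ℕ.*-commutativeSemigroup
    using () renaming (interchange to *-interchange)

  -- pascal a b = (a + b choose a), indexed by the two legs so that Pascal's rule is the defining recursion.
  pascal : ℕ → ℕ → ℕ
  pascal zero    b       = 1
  pascal (suc a) zero    = 1
  pascal (suc a) (suc b) = pascal a (suc b) + pascal (suc a) b

  pascal-zeroʳ : ∀ a → pascal a 0 ≡ 1
  pascal-zeroʳ zero    = refl
  pascal-zeroʳ (suc a) = refl

  pascal-comm : ∀ a b → pascal a b ≡ pascal b a
  pascal-comm zero    b       = ≡.sym (pascal-zeroʳ b)
  pascal-comm (suc a) zero    = refl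
  pascal-comm (suc a) (suc b) = ≡.trans (≡.cong₂ _+_ (pascal-comm a (suc b)) (pascal-comm (suc a) b))
                                        (ℕ.+-comm (pascal (suc b) a) (pascal b (suc a)))

  pascal-oneˡ : ∀ b → pascal 1 b ≡ suc b
  pascal-oneˡ zero    = refl
  pascal-oneˡ (suc b) = ≡.cong suc (pascal-oneˡ b)

  pascal-absorbˡ : ∀ a b → suc a * pascal (suc a) b ≡ suc (a + b) * pascal a b
  pascal-absorbˡ a       zero    rewrite pascal-zeroʳ a | ℕ.+-identityʳ a = refl
  pascal-absorbˡ zero    (suc b) rewrite pascal-oneˡ b = ≡.trans (ℕ.*-identityˡ _) (≡.sym (ℕ.*-identityʳ _))
  pascal-absorbˡ (suc a) (suc b) = begin
    suc (suc a) * (pascal (suc a) (suc b) + pascal (suc (suc a)) b)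
      ≡⟨ ℕ.*-distribˡ-+ (suc (suc a)) (pascal (suc a) (suc b)) (pascal (suc (suc a)) b) ⟩
    (X + Y) + suc a * pascal (suc a) (suc b) + suc (suc a) * pascal (suc (suc a)) b
      ≡⟨ ≡.cong₂ (λ m n → (X + Y) + m + n) (pascal-absorbˡ a (suc b)) (pascal-absorbˡ (suc a) b) ⟩
    (X + Y) + suc (a + suc b) * X + suc (suc a + b) * Y
      ≡⟨ ≡.cong (λ m → (X + Y) + suc m * X + suc (suc a + b) * Y) (ℕ.+-suc a b) ⟩
    (X + Y) + suc (suc (a + b)) * X + suc (suc (a + b)) * Y
      ≡⟨ collect X Y (a + b) ⟩
    suc (suc (suc (a + b))) * (X + Y)
      ≡⟨ ≡.cong (λ m → suc (suc m) * (X + Y)) (ℕ.+-suc a b) ⟨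
    suc (suc a + suc b) * (X + Y)
      ∎
    where
    open ≡.≡-Reasoning
    X = pascal a (suc b)
    Y = pascal (suc a) b
    collect : ∀ X Y r → (X + Y) + suc (suc r) * X + suc (suc r) * Y ≡ suc (suc (suc r)) * (X + Y)
    collect = solve-∀

  pascal-absorbʳ : ∀ a b → suc b * pascal a (suc b) ≡ suc (a + b) * pascal a b
  pascal-absorbʳ a b = begin
    suc b * pascal a (suc b)   ≡⟨ ≡.cong (suc b *_) (pascal-comm a (suc b)) ⟩
    suc b * pascal (suc b) a   ≡⟨ pascal-absorbˡ b a ⟩
    suc (b + a) * pascal b a   ≡⟨ ≡.cong₂ (λ m n → suc m * n) (ℕ.+-comm b a) (pascal-comm b a) ⟩
    suc (a + b) * pascal a b   ∎
    where open ≡.≡-Reasoning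

  record LogConcave (x y z : ℕ) : Set where
    constructor logConcave
    field
      x*z≤y*y : x * z ≤ y * y

  logConcave-sym : ∀ {x y z} → LogConcave x y z → LogConcave z y x
  logConcave-sym {x} {y} {z} (logConcave xz≤yy) =
    logConcave (≡.subst (_≤ y * y) (ℕ.*-comm x z) xz≤yy)

  logConcave-* : ∀ {x₁ x₂ x₃ y₁ y₂ y₃} → LogConcave x₁ x₂ x₃ → LogConcave y₁ y₂ y₃ →
    LogConcave (x₁ * y₁) (x₂ * y₂) (x₃ * y₃)
  logConcave-* {x₁} {x₂} {x₃} {y₁} {y₂} {y₃} (logConcave lc₁) (logConcave lc₂) =
    logConcave (begin
    (x₁ * y₁) * (x₃ * y₃) ≡⟨ *-interchange x₁ y₁ x₃ y₃ ⟩
    (x₁ * x₃) * (y₁ * y₃) ≤⟨ ℕ.*-mono-≤ lc₁ lc₂ ⟩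
    (x₂ * x₂) * (y₂ * y₂) ≡⟨ *-interchange x₂ y₂ x₂ y₂ ⟨
    (x₂ * y₂) * (x₂ * y₂) ∎)
    where open ℕ.≤-Reasoning

  -- x / y = p′ / p and z / y = q′ / q, and the product of these two ratios is at most 1.
  logConcave-ratios : ∀ p q p′ q′ {x y z} .{{_ : NonZero (p * q)}} →
    p * x ≡ p′ * y → q * z ≡ q′ * y → p′ * q′ ≤ p * q → LogConcave x y z
  logConcave-ratios p q p′ q′ {x} {y} {z} px≡p′y qz≡q′y p′q′≤pq =
    logConcave (ℕ.*-cancelˡ-≤ (p * q) (begin
    (p * q) * (x * z)   ≡⟨ *-interchange p q x z ⟩
    (p * x) * (q * z)   ≡⟨ ≡.cong₂ _*_ px≡p′y qz≡q′y ⟩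
    (p′ * y) * (q′ * y) ≡⟨ *-interchange p′ q′ y y ⟨
    (p′ * q′) * (y * y) ≤⟨ ℕ.*-monoˡ-≤ (y * y) p′q′≤pq ⟩
    (p * q) * (y * y)   ∎))
    where open ℕ.≤-Reasoning

  pascal-logConcaveʳ : ∀ a b → LogConcave (pascal a b) (pascal a (suc b)) (pascal a (suc (suc b)))
  pascal-logConcaveʳ a b = logConcave-ratios (suc (a + b)) (suc (suc b)) (suc b) (suc (a + suc b))
    (≡.sym (pascal-absorbʳ a b)) (pascal-absorbʳ a (suc b))
    (≡.subst (suc b * suc (a + suc b) ≤_) (ratio a b) (ℕ.m≤m+n _ a))
    where
    ratio : ∀ a b → suc b * suc (a + suc b) + a ≡ suc (a + b) * suc (suc b)
    ratio = solve-∀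

  pascal-logConcaveˡ : ∀ a b → LogConcave (pascal a b) (pascal (suc a) b) (pascal (suc (suc a)) b)
  pascal-logConcaveˡ a b
    rewrite pascal-comm a b | pascal-comm (suc a) b | pascal-comm (suc (suc a)) b = pascal-logConcaveʳ b a

  pascal-logConcave-antidiagonal : ∀ a b →
    LogConcave (pascal (suc (suc a)) b) (pascal (suc a) (suc b)) (pascal a (suc (suc b)))
  pascal-logConcave-antidiagonal a b = logConcave-ratios (suc (suc a)) (suc (suc b)) (suc b) (suc a)
    {pascal (suc (suc a)) b} {pascal (suc a) (suc b)} {pascal a (suc (suc b))}
    (≡.trans (pascal-absorbˡ (suc a) b) (≡.sym (pascal-absorbʳ (suc a) b)))
    (≡.trans (pascal-absorbʳ a (suc b)) (≡.sym (pascal-absorbˡ a (suc b))))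
    (≡.subst (suc b * suc a ≤_) (ratio a b) (ℕ.m≤m+n _ _))
    where
    ratio : ∀ a b → suc b * suc a + (a + b + 3) ≡ suc (suc a) * suc (suc b)
    ratio = solve-∀

  -- T i j k is the coefficient of u^i v^j w^k in P_{1/(i+j+k)}.
  T : ℕ → ℕ → ℕ → ℕ
  T zero    j zero    = 1
  T zero    j (suc k) = 0
  T (suc i) j k       = pascal (suc i) j * pascal i k

  T-logConcave-u : ∀ i j k →
    LogConcave (T (suc i) j (suc (suc k))) (T (suc (suc i)) j (suc k)) (T (suc (suc (suc i))) j k)
  T-logConcave-u i j k =
    logConcave-* (pascal-logConcaveˡ (suc i) j) (logConcave-sym (pascal-logConcave-antidiagonal i k))

  T-logConcave-v : ∀ i j k →
    LogConcave (T (suc i) j (suc (suc k))) (T (suc i) (suc j) (suc k)) (T (suc i) (suc (suc j)) k)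
  T-logConcave-v i j k =
    logConcave-* (pascal-logConcaveʳ (suc i) j) (logConcave-sym (pascal-logConcaveʳ i k))

  T-logConcave-uv : ∀ i j k →
    LogConcave (T i (suc (suc j)) k) (T (suc i) (suc j) k) (T (suc (suc i)) j k)
  T-logConcave-uv zero    j zero    =
    logConcave-* (logConcave-sym (pascal-logConcave-antidiagonal 0 j)) (logConcave {1} {1} {1} ℕ.≤-refl)
  T-logConcave-uv zero    j (suc k) = logConcave z≤n
  T-logConcave-uv (suc i) j k =
    logConcave-* (logConcave-sym (pascal-logConcave-antidiagonal (suc i) j)) (pascal-logConcaveˡ i k)

open Pascal

-- Series = ℤ[[w]][[v]][[u]]: the outermost index is the exponent of u.
module W   = PowerSeriesRing ℤ.+-*-commutativeRing
module VW  = PowerSeriesRing W.commutativeRing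
module UVW = PowerSeriesRing VW.commutativeRing
module VWᵣ  = CommutativeRing VW.commutativeRing
module UVWᵣ = CommutativeRing UVW.commutativeRing
open UVW using (_+ₚ_; _*ₚ_; -ₚ_; 0ₚ; 1ₚ)

sumTo-cong : ∀ n {f g : ℕ → ℤ} → (∀ a → f a ≡ g a) → sumTo n f ≡ sumTo n g
sumTo-cong zero    f≡g = f≡g zero
sumTo-cong (suc n) f≡g = ≡.cong₂ ℤ._+_ (sumTo-cong n f≡g) (f≡g (suc n))

⊛≈*ₚ : ∀ f g → f ⊛ g ≈ˢ f *ₚ g
⊛≈*ₚ f g i j k = ≡.sym (≡.trans (UVW-∑ i _ j k) (sumTo-cong i λ a →
                   ≡.trans (VW-∑ j _ k) (sumTo-cong j λ b → W-∑ k _)))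
  where
  W-∑ : ∀ n F → W.∑ n F ≡ sumTo n F
  W-∑ zero    F = refl
  W-∑ (suc n) F = ≡.cong (ℤ._+ F (suc n)) (W-∑ n F)
  VW-∑ : ∀ n F k → VW.∑ n F k ≡ sumTo n (λ a → F a k)
  VW-∑ zero    F k = refl
  VW-∑ (suc n) F k = ≡.cong (ℤ._+ F (suc n) k) (VW-∑ n F k)
  UVW-∑ : ∀ n F j k → UVW.∑ n F j k ≡ sumTo n (λ a → F a j k)
  UVW-∑ zero    F j k = refl
  UVW-∑ (suc n) F j k = ≡.cong (ℤ._+ F (suc n) j k) (UVW-∑ n F j k)

mono≈monomial : ∀ a b c → mono a b c ≈ˢ UVW.monomial a (VW.monomial b (W.monomial c (+ 1)))
mono≈monomial a b c i j k with i ℕ.≡ᵇ a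
... | false = refl
... | true with j ℕ.≡ᵇ b
...   | false = refl
...   | true with k ℕ.≡ᵇ c
...     | false = refl
...     | true  = refl

shift³ : ℕ → ℕ → ℕ → Series → Series
shift³ a b c F = UVW.shift a (λ i → VW.shift b (λ j → W.shift c (F i j)))

mono-*ₚ : ∀ a b c F → mono a b c *ₚ F ≈ˢ shift³ a b c F
mono-*ₚ a b c F = UVWᵣ.trans
  (UVW.*ₚ-cong {g = F} (mono≈monomial a b c) (λ _ _ _ → refl))
  (UVWᵣ.trans (UVW.monomial-*ₚ a _ F)
              (UVW.shift-cong a λ i → VWᵣ.trans (VW.monomial-*ₚ b _ (F i))
                                                (VW.shift-cong b λ j → W.monomial-1#-*ₚ c (F i j))))

↑u ↑v ↑w : Series → Series
↑u = shift³ 1 0 0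
↑v = shift³ 0 1 0
↑w = shift³ 0 0 1

shift³-cong : ∀ a b c {F G} → F ≈ˢ G → shift³ a b c F ≈ˢ shift³ a b c G
shift³-cong a b c F≈G = UVW.shift-cong a λ i → VW.shift-cong b λ j → W.shift-cong c (F≈G i j)

↑v-mono : ∀ a b c → ↑v (mono a b c) ≈ˢ mono a (suc b) c
↑v-mono a b c i zero    k with i ℕ.≡ᵇ a
... | false = refl
... | true  = refl
↑v-mono a b c i (suc j) k = refl

↑w-mono : ∀ a b c → ↑w (mono a b c) ≈ˢ mono a b (suc c)
↑w-mono a b c i j zero    with i ℕ.≡ᵇ a
... | false = refl
... | true with j ℕ.≡ᵇ b
...   | false = refl
...   | true  = refl
↑w-mono a b c i j (suc k) = refl

record Homogeneous (n : ℕ) (C F : Series) : Set where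
  field
    onDegree  : ∀ i j k → i ℕ.+ j ℕ.+ k ≡ n → F i j k ≡ C i j k
    offDegree : ∀ i j k → i ℕ.+ j ℕ.+ k ≢ n → F i j k ≡ + 0
open Homogeneous

homogeneous-resp : ∀ {n C F G} → F ≈ˢ G → Homogeneous n C F → Homogeneous n C G
homogeneous-resp F≈G hom = record
  { onDegree  = λ i j k e → ≡.trans (≡.sym (F≈G i j k)) (onDegree hom i j k e)
  ; offDegree = λ i j k e → ≡.trans (≡.sym (F≈G i j k)) (offDegree hom i j k e)
  }

homogeneous-coefficients : ∀ {n C D F} → (∀ i j k → i ℕ.+ j ℕ.+ k ≡ n → C i j k ≡ D i j k) →
  Homogeneous n C F → Homogeneous n D F
homogeneous-coefficients C≡D hom = record
  { onDegree  = λ i j k e → ≡.trans (onDegree hom i j k e) (C≡D i j k e)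
  ; offDegree = offDegree hom
  }

homogeneous-+ : ∀ {n C D F G} → Homogeneous n C F → Homogeneous n D G → Homogeneous n (C +ₚ D) (F +ₚ G)
homogeneous-+ homF homG = record
  { onDegree  = λ i j k e → ≡.cong₂ ℤ._+_ (onDegree homF i j k e) (onDegree homG i j k e)
  ; offDegree = λ i j k e → ≡.cong₂ ℤ._+_ (offDegree homF i j k e) (offDegree homG i j k e)
  }

homogeneous-neg : ∀ {n C F} → Homogeneous n C F → Homogeneous n (-ₚ C) (-ₚ F)
homogeneous-neg hom = record
  { onDegree  = λ i j k e → ≡.cong ℤ.-_ (onDegree hom i j k e)
  ; offDegree = λ i j k e → ≡.cong ℤ.-_ (offDegree hom i j k e)
  }

≡ᵇ-true⇒≡ : ∀ m n → (m ℕ.≡ᵇ n) ≡ true → m ≡ n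
≡ᵇ-true⇒≡ m n eq = ℕ.≡ᵇ⇒≡ m n (≡.subst Bool.T (≡.sym eq) _)

mono-homogeneous : ∀ a b c → Homogeneous (a ℕ.+ b ℕ.+ c) (mono a b c) (mono a b c)
mono-homogeneous a b c = record { onDegree = λ _ _ _ _ → refl ; offDegree = off }
  where
  off : ∀ i j k → i ℕ.+ j ℕ.+ k ≢ a ℕ.+ b ℕ.+ c → mono a b c i j k ≡ + 0
  off i j k ne with i ℕ.≡ᵇ a in i≡a
  ... | false = refl
  ... | true with j ℕ.≡ᵇ b in j≡b
  ...   | false = refl
  ...   | true with k ℕ.≡ᵇ c in k≡c
  ...     | false = refl
  ...     | true  = contradiction (≡.cong₂ ℕ._+_ (≡.cong₂ ℕ._+_ (≡ᵇ-true⇒≡ i a i≡a) (≡ᵇ-true⇒≡ j b j≡b))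
                                             (≡ᵇ-true⇒≡ k c k≡c)) ne

↑u-homogeneous : ∀ {n C F} → Homogeneous n C F → Homogeneous (suc n) (↑u C) (↑u F)
↑u-homogeneous {n} {C} {F} hom = record { onDegree = on ; offDegree = off }
  where
  on : ∀ i j k → i ℕ.+ j ℕ.+ k ≡ suc n → ↑u F i j k ≡ ↑u C i j k
  on zero    j k _ = refl
  on (suc i) j k e = onDegree hom i j k (ℕ.suc-injective e)
  off : ∀ i j k → i ℕ.+ j ℕ.+ k ≢ suc n → ↑u F i j k ≡ + 0
  off zero    j k _  = refl
  off (suc i) j k ne = offDegree hom i j k (ne ∘ ≡.cong suc)

↑v-homogeneous : ∀ {n C F} → Homogeneous n C F → Homogeneous (suc n) (↑v C) (↑v F)
↑v-homogeneous {n} {C} {F} hom = record { onDegree = on ; offDegree = off }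
  where
  degree : ∀ i j k → i ℕ.+ suc j ℕ.+ k ≡ suc (i ℕ.+ j ℕ.+ k)
  degree i j k = ≡.cong (ℕ._+ k) (ℕ.+-suc i j)
  on : ∀ i j k → i ℕ.+ j ℕ.+ k ≡ suc n → ↑v F i j k ≡ ↑v C i j k
  on i zero    k _ = refl
  on i (suc j) k e = onDegree hom i j k (ℕ.suc-injective (≡.trans (≡.sym (degree i j k)) e))
  off : ∀ i j k → i ℕ.+ j ℕ.+ k ≢ suc n → ↑v F i j k ≡ + 0
  off i zero    k _  = refl
  off i (suc j) k ne = offDegree hom i j k (ne ∘ ≡.trans (degree i j k) ∘ ≡.cong suc)

↑w-homogeneous : ∀ {n C F} → Homogeneous n C F → Homogeneous (suc n) (↑w C) (↑w F)
↑w-homogeneous {n} {C} {F} hom = record { onDegree = on ; offDegree = off }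
  where
  on : ∀ i j k → i ℕ.+ j ℕ.+ k ≡ suc n → ↑w F i j k ≡ ↑w C i j k
  on i j zero    _ = refl
  on i j (suc k) e = onDegree hom i j k (ℕ.suc-injective (≡.trans (≡.sym (ℕ.+-suc (i ℕ.+ j) k)) e))
  off : ∀ i j k → i ℕ.+ j ℕ.+ k ≢ suc n → ↑w F i j k ≡ + 0
  off i j zero    _  = refl
  off i j (suc k) ne = offDegree hom i j k (ne ∘ ≡.trans (ℕ.+-suc (i ℕ.+ j) k) ∘ ≡.cong suc)

Tˢ : Series
Tˢ i j k = + T i j k

+m-+o≡+n : ∀ {m n o} → n ℕ.+ o ≡ m → + m ℤ.- + o ≡ + n
+m-+o≡+n {n = n} {o} refl = ≡.trans (ℤ.[+m]-[+n]≡m⊖n (n ℕ.+ o) o)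
  (≡.trans (ℤ.⊖-≥ (ℕ.m≤n+m o n)) (≡.cong +_ (ℕ.m+n∸n≡m n o)))

T-zeroʳ : ∀ i j → T i j 0 ≡ pascal i j
T-zeroʳ zero    j = refl
T-zeroʳ (suc i) j rewrite pascal-zeroʳ i = ℕ.*-identityʳ _

T-recurrence : ∀ i j k → 2 ≤ i ℕ.+ j ℕ.+ k →
  (↑u Tˢ +ₚ ↑v Tˢ +ₚ ↑w Tˢ +ₚ -ₚ ↑v (↑w Tˢ)) i j k ≡ Tˢ i j k
T-recurrence zero          zero    (suc zero)    (s≤s ())
T-recurrence zero          zero    (suc (suc k)) _ = refl
T-recurrence zero          (suc j) zero          _ = refl
T-recurrence zero          (suc j) (suc zero)    _ = refl
T-recurrence zero          (suc j) (suc (suc k)) _ = refl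
T-recurrence (suc i)       zero    zero          _ rewrite T-zeroʳ i 0 | pascal-zeroʳ i = refl
T-recurrence (suc i)       (suc j) zero          _ rewrite T-zeroʳ i (suc j) | pascal-zeroʳ i =
  +m-+o≡+n (identity (pascal i (suc j)) (pascal (suc i) j))
  where
  identity : ∀ X Y → (X ℕ.+ Y) ℕ.* 1 ℕ.+ 0 ≡ X ℕ.+ Y ℕ.* 1 ℕ.+ 0
  identity = solve-∀
T-recurrence (suc zero)    zero    (suc k)       _ = refl
T-recurrence (suc (suc i)) zero    (suc k)       _ =
  +m-+o≡+n (identity (pascal i (suc k)) (pascal (suc i) k))
  where
  identity : ∀ X Y → 1 ℕ.* (X ℕ.+ Y) ℕ.+ 0 ≡ 1 ℕ.* X ℕ.+ 0 ℕ.+ 1 ℕ.* Y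
  identity = solve-∀
T-recurrence (suc zero)    (suc j) (suc k)       _ =
  +m-+o≡+n (identity (pascal 1 j))
  where
  identity : ∀ Y → (1 ℕ.+ Y) ℕ.* 1 ℕ.+ Y ℕ.* 1 ≡ 0 ℕ.+ Y ℕ.* 1 ℕ.+ (1 ℕ.+ Y) ℕ.* 1
  identity = solve-∀
T-recurrence (suc (suc i)) (suc j) (suc k)       _ =
  +m-+o≡+n (identity (pascal (suc i) (suc j)) (pascal (suc (suc i)) j) (pascal i (suc k)) (pascal (suc i) k))
  where
  identity : ∀ X Y U V →
    (X ℕ.+ Y) ℕ.* (U ℕ.+ V) ℕ.+ Y ℕ.* V ≡ X ℕ.* U ℕ.+ Y ℕ.* (U ℕ.+ V) ℕ.+ (X ℕ.+ Y) ℕ.* V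
  identity = solve-∀

sˢ eˢ : Series
sˢ = uˢ +ₚ vˢ +ₚ wˢ
eˢ = mono 0 1 1

X : ℕ → Series
X n = mono 1 n (suc n)

Q : ℕ → Series
Q zero          = 1ₚ
Q (suc zero)    = uˢ +ₚ vˢ
Q (suc (suc n)) = sˢ *ₚ Q (suc n) +ₚ -ₚ (eˢ *ₚ Q n)

module ≈ˢ-Reasoning = SetoidReasoning UVWᵣ.setoid

X-recurrence : ∀ n → X (suc n) ≈ˢ eˢ *ₚ X n
X-recurrence n = UVWᵣ.sym (UVWᵣ.trans (mono-*ₚ 0 1 1 (X n)) (UVWᵣ.trans
  (shift³-cong 0 1 0 {↑w (X n)} {mono 1 n (suc (suc n))} (↑w-mono 1 n (suc n)))
  (↑v-mono 1 n (suc (suc n)))))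

wˢ*Q₁ : wˢ *ₚ Q 1 ≈ˢ X 0 +ₚ eˢ
wˢ*Q₁ = UVWᵣ.trans (UVWᵣ.distribˡ wˢ uˢ vˢ) (UVWᵣ.+-cong
  (UVWᵣ.trans (mono-*ₚ 0 0 1 uˢ) (↑w-mono 1 0 0))
  (UVWᵣ.trans (mono-*ₚ 0 0 1 vˢ) (↑w-mono 0 1 0)))

Q-markov₀ : Q 2 *ₚ Q 0 ≈ˢ X 0 +ₚ Q 1 *ₚ Q 1
Q-markov₀ = begin
  Q 2 *ₚ 1ₚ                             ≈⟨ UVWᵣ.*-identityʳ (Q 2) ⟩
  (Q 1 +ₚ wˢ) *ₚ Q 1 +ₚ -ₚ (eˢ *ₚ 1ₚ)  ≈⟨ UVWᵣ.+-cong (UVWᵣ.distribʳ (Q 1) (Q 1) wˢ)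
                                                      (UVWᵣ.-‿cong (UVWᵣ.*-identityʳ eˢ)) ⟩
  Q₁² +ₚ wˢ *ₚ Q 1 +ₚ -ₚ eˢ             ≈⟨ UVWᵣ.+-congʳ { -ₚ eˢ} (UVWᵣ.+-congˡ {Q₁²} wˢ*Q₁) ⟩
  Q₁² +ₚ (X 0 +ₚ eˢ) +ₚ -ₚ eˢ           ≈⟨ UVWᵣ.+-congʳ { -ₚ eˢ} (UVWᵣ.+-assoc Q₁² (X 0) eˢ) ⟨
  Q₁² +ₚ X 0 +ₚ eˢ +ₚ -ₚ eˢ             ≈⟨ UVWᵣ.+-assoc (Q₁² +ₚ X 0) eˢ (-ₚ eˢ) ⟩
  Q₁² +ₚ X 0 +ₚ (eˢ +ₚ -ₚ eˢ)           ≈⟨ UVWᵣ.+-congˡ {Q₁² +ₚ X 0} (UVWᵣ.-‿inverseʳ eˢ) ⟩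
  Q₁² +ₚ X 0 +ₚ 0ₚ                      ≈⟨ UVWᵣ.+-identityʳ (Q₁² +ₚ X 0) ⟩
  Q₁² +ₚ X 0                            ≈⟨ UVWᵣ.+-comm Q₁² (X 0) ⟩
  X 0 +ₚ Q₁²                            ∎
  where
  open ≈ˢ-Reasoning
  Q₁² = Q 1 *ₚ Q 1

Q-markov : ∀ n → Q (suc (suc n)) *ₚ Q n ≈ˢ X n +ₚ Q (suc n) *ₚ Q (suc n)
Q-markov =
  Casoratian.casoratian UVW.commutativeRing {sˢ} {eˢ} Q X (λ _ → UVWᵣ.refl) X-recurrence Q-markov₀
Q-shifts : ∀ n →
  Q (suc (suc n)) ≈ˢ ↑u (Q (suc n)) +ₚ ↑v (Q (suc n)) +ₚ ↑w (Q (suc n)) +ₚ -ₚ ↑v (↑w (Q n))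
Q-shifts n = UVWᵣ.+-cong s*Q₁≈ (UVWᵣ.-‿cong {eˢ *ₚ Q n} {↑v (↑w (Q n))} (mono-*ₚ 0 1 1 (Q n)))
  where
  Q₁ = Q (suc n)
  s*Q₁≈ : sˢ *ₚ Q₁ ≈ˢ ↑u Q₁ +ₚ ↑v Q₁ +ₚ ↑w Q₁
  s*Q₁≈ = begin
    (uˢ +ₚ vˢ +ₚ wˢ) *ₚ Q₁
      ≈⟨ UVWᵣ.distribʳ Q₁ (uˢ +ₚ vˢ) wˢ ⟩
    (uˢ +ₚ vˢ) *ₚ Q₁ +ₚ wˢ *ₚ Q₁
      ≈⟨ UVWᵣ.+-congʳ {wˢ *ₚ Q₁} (UVWᵣ.distribʳ Q₁ uˢ vˢ) ⟩
    uˢ *ₚ Q₁ +ₚ vˢ *ₚ Q₁ +ₚ wˢ *ₚ Q₁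
      ≈⟨ UVWᵣ.+-cong (UVWᵣ.+-cong (mono-*ₚ 1 0 0 Q₁) (mono-*ₚ 0 1 0 Q₁)) (mono-*ₚ 0 0 1 Q₁) ⟩
    ↑u Q₁ +ₚ ↑v Q₁ +ₚ ↑w Q₁
      ∎
    where open ≈ˢ-Reasoning

shifts-homogeneous : ∀ {n F₀ F₁} → Homogeneous (suc n) Tˢ F₁ → Homogeneous n Tˢ F₀ →
  Homogeneous (suc (suc n)) Tˢ (↑u F₁ +ₚ ↑v F₁ +ₚ ↑w F₁ +ₚ -ₚ ↑v (↑w F₀))
shifts-homogeneous H₁ H₀ =
  homogeneous-coefficients (λ i j k e → T-recurrence i j k (≡.subst (2 ≤_) (≡.sym e) (s≤s (s≤s z≤n))))
    (homogeneous-+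
      (homogeneous-+ (homogeneous-+ (↑u-homogeneous H₁) (↑v-homogeneous H₁)) (↑w-homogeneous H₁))
      (homogeneous-neg (↑v-homogeneous (↑w-homogeneous H₀))))

Q-homogeneous : ∀ n → Homogeneous n Tˢ (Q n)
Q-homogeneous zero = homogeneous-resp (mono≈monomial 0 0 0)
  (homogeneous-coefficients degree0 (mono-homogeneous 0 0 0))
  where
  degree0 : ∀ i j k → i ℕ.+ j ℕ.+ k ≡ 0 → mono 0 0 0 i j k ≡ Tˢ i j k
  degree0 zero zero zero refl = refl
Q-homogeneous (suc zero) =
  homogeneous-coefficients degree1 (homogeneous-+ (mono-homogeneous 1 0 0) (mono-homogeneous 0 1 0))
  where
  degree1 : ∀ i j k → i ℕ.+ j ℕ.+ k ≡ 1 → (uˢ +ₚ vˢ) i j k ≡ Tˢ i j k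
  degree1 (suc zero) zero       zero       refl = refl
  degree1 zero       (suc zero) zero       refl = refl
  degree1 zero       zero       (suc zero) refl = refl
Q-homogeneous (suc (suc n)) = homogeneous-resp (UVWᵣ.sym (Q-shifts n))
  (shifts-homogeneous (Q-homogeneous (suc n)) (Q-homogeneous n))

Q-nonZeroDivisor : ∀ m → NonZeroDivisor UVW.commutativeRing (Q m)
Q-nonZeroDivisor m = UVW.initial-nonZeroDivisor 0 {Q m} (λ _ ())
  (VW.initial-nonZeroDivisor m {Q m 0} below-v^m
    (W.initial-nonZeroDivisor 0 {Q m 0 m} (λ _ ())
      (≡.subst (NonZeroDivisor ℤ.+-*-commutativeRing) (≡.sym v^m-coefficient)
               (1#-nonZeroDivisor ℤ.+-*-commutativeRing))))
  where
  hom = Q-homogeneous m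
  v^m-coefficient : Q m 0 m 0 ≡ + 1
  v^m-coefficient = onDegree hom 0 m 0 (ℕ.+-identityʳ m)
  below-v^m : ∀ j → j < m → ∀ k → Q m 0 j k ≡ + 0
  below-v^m j j<m k with j ℕ.+ k ℕ.≟ m
  ... | no  ≢m = offDegree hom 0 j k ≢m
  ... | yes ≡m with k
  ...   | zero  = contradiction (≡.trans (≡.sym (ℕ.+-identityʳ j)) ≡m) (ℕ.<⇒≢ j<m)
  ...   | suc _ = onDegree hom 0 j _ ≡m

markovNumerators≈Q : ∀ P → IsMarkovNumerators P → ∀ n → P n ≈ˢ Q n
markovNumerators≈Q P (P₀≈1 , P₁≈u+v , P-markov) = P≈Q
  where
  open ≈ˢ-Reasoning
  P≈Q : ∀ n → P n ≈ˢ Q n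
  P≈Q zero          = UVWᵣ.trans P₀≈1 (mono≈monomial 0 0 0)
  P≈Q (suc zero)    = P₁≈u+v
  P≈Q (suc (suc n)) = nonZeroDivisor-cancelʳ UVW.commutativeRing {Q n} {P (suc (suc n))} {Q (suc (suc n))}
    (Q-nonZeroDivisor n) (begin
    P (suc (suc n)) *ₚ Q n                  ≈⟨ UVWᵣ.*-congˡ {P (suc (suc n))} (UVWᵣ.sym (P≈Q n)) ⟩
    P (suc (suc n)) *ₚ P n                  ≈⟨ UVWᵣ.sym (⊛≈*ₚ (P (suc (suc n))) (P n)) ⟩
    P (suc (suc n)) ⊛ P n                   ≈⟨ P-markov n ⟩
    X n ⊕ P (suc n) ⊛ P (suc n)             ≈⟨ UVWᵣ.+-congˡ {X n} (UVWᵣ.trans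
                                                 (⊛≈*ₚ (P (suc n)) (P (suc n)))
                                                 (UVWᵣ.*-cong (P≈Q (suc n)) (P≈Q (suc n)))) ⟩
    X n +ₚ Q (suc n) *ₚ Q (suc n)           ≈⟨ UVWᵣ.sym (Q-markov n) ⟩
    Q (suc (suc n)) *ₚ Q n                  ∎)

coeffA≡T : ∀ P → IsMarkovNumerators P →
  ∀ {n i j k} → i ℕ.+ j ℕ.+ k ≡ n → coeffA P n i j ≡ + T i j k
coeffA≡T P markov {i = i} {j} {k} refl = ≡.trans (≡.cong (P _ i j) (ℕ.m+n∸m≡n (i ℕ.+ j) k))
  (≡.trans (markovNumerators≈Q P markov _ i j k) (onDegree (Q-homogeneous _) i j k refl))

logConcave⇒LCAt : ∀ {a b c} → LogConcave a b c → LCAt (+ a) (+ b) (+ c)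
logConcave⇒LCAt {a} {b} {c} (logConcave ac≤bb) =
  ≡.subst₂ ℤ._≤_ (ℤ.pos-* a c) (ℤ.pos-* b b) (ℤ.+≤+ ac≤bb)

coeffA-logConcave : ∀ P → IsMarkovNumerators P → ∀ {n i₁ j₁ k₁ i₂ j₂ k₂ i₃ j₃ k₃} →
  i₁ ℕ.+ j₁ ℕ.+ k₁ ≡ n → i₂ ℕ.+ j₂ ℕ.+ k₂ ≡ n → i₃ ℕ.+ j₃ ℕ.+ k₃ ≡ n →
  LogConcave (T i₁ j₁ k₁) (T i₂ j₂ k₂) (T i₃ j₃ k₃) →
  LCAt (coeffA P n i₁ j₁) (coeffA P n i₂ j₂) (coeffA P n i₃ j₃)
coeffA-logConcave P markov d₁ d₂ d₃ lc =
  LCAt-resp (coeffA≡T P markov d₁) (coeffA≡T P markov d₂) (coeffA≡T P markov d₃) (logConcave⇒LCAt lc)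
  where
  LCAt-resp : ∀ {x y z x′ y′ z′} → x ≡ x′ → y ≡ y′ → z ≡ z′ → LCAt x′ y′ z′ → LCAt x y z
  LCAt-resp refl refl refl lc′ = lc′

move-w→u : ∀ i j k → i ℕ.+ j ℕ.+ suc k ≡ suc i ℕ.+ j ℕ.+ k
move-w→u i j k = ℕ.+-suc (i ℕ.+ j) k

move-v→u : ∀ i j k → i ℕ.+ suc j ℕ.+ k ≡ suc i ℕ.+ j ℕ.+ k
move-v→u i j k = ≡.cong (ℕ._+ k) (ℕ.+-suc i j)

move-w→v : ∀ i j k → i ℕ.+ j ℕ.+ suc k ≡ i ℕ.+ suc j ℕ.+ k
move-w→v i j k = ≡.trans (move-w→u i j k) (≡.sym (move-v→u i j k))

Δ-column₀ : ∀ {n j} → InΔ n 0 j → n ≤ j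
Δ-column₀ {n} {j} (n≤n*0+j , _) = ≡.subst (n ≤_) (≡.cong (ℕ._+ j) (ℕ.*-zeroʳ n)) n≤n*0+j

module _ (P : ℕ → Series) (markov : IsMarkovNumerators P) (n : ℕ) where

  coeffA-logConcave-u : ∀ i j → InΔ n i j → InΔ n (suc i) j → InΔ n (suc (suc i)) j →
    LCAt (coeffA P n i j) (coeffA P n (suc i) j) (coeffA P n (suc (suc i)) j)
  coeffA-logConcave-u zero    j Δ₀ Δ₁ _  = contradiction (Δ-column₀ Δ₀) (ℕ.<⇒≱ (proj₂ Δ₁))
  coeffA-logConcave-u (suc i) j _  _  Δ₂ = coeffA-logConcave P markov d₁ d₂ d₃ (T-logConcave-u i j k)
    where
    k  = n ∸ (suc (suc (suc i)) ℕ.+ j)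
    d₃ = ℕ.m+[n∸m]≡n (proj₂ Δ₂)
    d₂ = ≡.trans (move-w→u (suc (suc i)) j k) d₃
    d₁ = ≡.trans (move-w→u (suc i) j (suc k)) d₂

  coeffA-logConcave-v : ∀ i j → InΔ n i j → InΔ n i (suc j) → InΔ n i (suc (suc j)) →
    LCAt (coeffA P n i j) (coeffA P n i (suc j)) (coeffA P n i (suc (suc j)))
  coeffA-logConcave-v zero    j Δ₀ Δ₁ _  = contradiction (Δ-column₀ Δ₀) (ℕ.<⇒≱ (proj₂ Δ₁))
  coeffA-logConcave-v (suc i) j _  _  Δ₂ = coeffA-logConcave P markov d₁ d₂ d₃ (T-logConcave-v i j k)
    where
    k  = n ∸ (suc i ℕ.+ suc (suc j))
    d₃ = ℕ.m+[n∸m]≡n (proj₂ Δ₂)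
    d₂ = ≡.trans (move-w→v (suc i) (suc j) k) d₃
    d₁ = ≡.trans (move-w→v (suc i) j (suc k)) d₂

  coeffA-logConcave-uv : ∀ i j → InΔ n i (suc (suc j)) → InΔ n (suc i) (suc j) → InΔ n (suc (suc i)) j →
    LCAt (coeffA P n i (suc (suc j))) (coeffA P n (suc i) (suc j)) (coeffA P n (suc (suc i)) j)
  coeffA-logConcave-uv i j Δ₀ _ _ = coeffA-logConcave P markov d₁ d₂ d₃ (T-logConcave-uv i j k)
    where
    k  = n ∸ (i ℕ.+ suc (suc j))
    d₁ = ℕ.m+[n∸m]≡n (proj₂ Δ₀)
    d₂ = ≡.trans (≡.sym (move-v→u i (suc j) k)) d₁
    d₃ = ≡.trans (≡.sym (move-v→u (suc i) j k)) d₂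

theorem6p4 : (P : ℕ → Series) → IsMarkovNumerators P →
  (n : ℕ) → 1 ≤ n →
    ((i j : ℕ) → InΔ n i j → InΔ n (suc i) j → InΔ n (suc (suc i)) j →
      LCAt (coeffA P n i j) (coeffA P n (suc i) j) (coeffA P n (suc (suc i)) j))
    × ((i j : ℕ) → InΔ n i j → InΔ n i (suc j) → InΔ n i (suc (suc j)) →
      LCAt (coeffA P n i j) (coeffA P n i (suc j)) (coeffA P n i (suc (suc j))))
    × ((i j : ℕ) → InΔ n i (suc (suc j)) → InΔ n (suc i) (suc j) → InΔ n (suc (suc i)) j →
      LCAt (coeffA P n i (suc (suc j))) (coeffA P n (suc i) (suc j)) (coeffA P n (suc (suc i)) j))
theorem6p4 P markov n _ =
  coeffA-logConcave-u P markov n , coeffA-logConcave-v P markov n , coeffA-logConcave-uv P markov n
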